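{- For $r,m\in\mathbb{N}$ with $r<m$, \[ \sum_{n=1}^{\infty}\frac{h_{n}^{(r)}}{n^{m}}=\frac{1}{(r-1)!}\sum_{k=1}^{r}{r\brack k}\left\{\zeta_{H}(m-k+1)-H_{r-1}\zeta(m-k+1)+\sum_{j=1}^{r-1}\mu(m-k+1,j)\right\}. \]
   Context: Hyperharmonic numbers: $h_n^{(0)}=1/n$ for $n\in\mathbb{N}=\{1,2,3,\dots\}$, and for $r\in\mathbb{N}$, $h_n^{(r)}=\sum_{k=1}^{n}h_k^{(r-1)}$. $H_n=\sum_{k=1}^n 1/k$ is the $n$-th harmonic number, with $H_0=0$. $\zeta$ is the Riemann zeta function and $\zeta_H(s)=\sum_{n=1}^\infty H_n/n^s$. For a positive integer $s$ and $j>0$, $\mu(s,j)=\sum_{n=1}^{\infty}\frac{1}{n^{s}(n+j)}$. ${r\brack k}$ denotes the unsigned Stirling numbers of the first kind, defined by $x(x+1)\cdots(x+r-1)=\sum_{k=0}^{r}{r\brack k}x^k$. An empty sum is zero. -}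

module Defs where

open import Data.Nat as ℕ using (ℕ; zero; suc; _^_; _∸_)
open import Data.Nat using (_!)
open import Data.Integer using (+_)
open import Data.Rational using (ℚ; 0ℚ; _+_; _*_; _-_; _/_)
open import Data.List using (List; []; _∷_)

-- 1/n as a rational, with the (unused) convention 1/0 := 0
inv : ℕ → ℚ
inv zero    = 0ℚ
inv (suc n) = (+ 1) / suc n

fromℕ : ℕ → ℚ
fromℕ n = (+ n) / 1

sumTo : (ℕ → ℚ) → ℕ → ℚ
sumTo f zero    = 0ℚ
sumTo f (suc n) = sumTo f n + f (suc n)

-- hyperharmonic numbers h_n^{(r)}  (written hyp r n)
hyp : ℕ → ℕ → ℚ
hyp zero    n = inv n
hyp (suc r) n = sumTo (hyp r) n

H : ℕ → ℚ
H n = sumTo inv n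

-- Unsigned Stirling numbers of the first kind, as coefficients of the
-- rising factorial x(x+1)...(x+r-1) = Σ_k [r,k] x^k.
-- Polynomials are coefficient lists in ascending degree.
private
  addP : List ℕ → List ℕ → List ℕ
  addP []       q        = q
  addP p        []       = p
  addP (a ∷ p) (b ∷ q) = (a ℕ.+ b) ∷ addP p q

  scaleP : ℕ → List ℕ → List ℕ
  scaleP c []      = []
  scaleP c (a ∷ p) = (c ℕ.* a) ∷ scaleP c p

  coeff : List ℕ → ℕ → ℕ
  coeff []      k       = 0
  coeff (a ∷ p) zero    = a
  coeff (a ∷ p) (suc k) = coeff p k

mulLin : ℕ → List ℕ → List ℕ
mulLin c p = addP (scaleP c p) (0 ∷ p)

rising : ℕ → List ℕ
rising zero    = 1 ∷ []
rising (suc r) = mulLin r (rising r)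

stirling1 : ℕ → ℕ → ℕ
stirling1 r k = coeff (rising r) k

-- Truncations (partial sums up to N) of the series in the statement
-- Σ_{n=1}^N h_n^{(r)} / n^m
lhsN : ℕ → ℕ → ℕ → ℚ
lhsN r m N = sumTo (λ n → hyp r n * inv (n ^ m)) N

zetaN : ℕ → ℕ → ℚ
zetaN s N = sumTo (λ n → inv (n ^ s)) N

zetaHN : ℕ → ℕ → ℚ
zetaHN s N = sumTo (λ n → H n * inv (n ^ s)) N

muN : ℕ → ℕ → ℕ → ℚ
muN s j N = sumTo (λ n → inv (n ^ s ℕ.* (n ℕ.+ j))) N

rhsN : ℕ → ℕ → ℕ → ℚ
rhsN r m N =
  inv ((r ∸ 1) !) *
  sumTo (λ k → fromℕ (stirling1 r k) *
                 ( zetaHN (m ∸ k ℕ.+ 1) N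
                 - H (r ∸ 1) * zetaN (m ∸ k ℕ.+ 1) N
                 + sumTo (λ j → muN (m ∸ k ℕ.+ 1) j N) (r ∸ 1))) r

{-# OPTIONS --safe #-}
-- Every truncation of the identity holds exactly, so the ε–N statement is
-- immediate.  Induction on r and n gives the closed form
-- r! h_n^{(r+1)} = (n+1)(n+2)⋯(n+r) (H_{n+r} - H_r), and expanding
-- n (n+1)⋯(n+r-1) = Σ_k [r,k] n^k turns h_n^{(r)}/n^m into
-- (1/(r-1)!) Σ_k [r,k] (H_{n+r-1} - H_{r-1}) / n^{m-k+1}.  Splitting
-- H_{n+r-1} = H_n + Σ_{j=1}^{r-1} 1/(n+j) and summing over n ≤ N yields the
-- truncated ζ_H, ζ and μ series.
module Submission where

open import Defs
open import Data.Nat using (ℕ; _≤_; _<_)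
open import Data.Product using (∃-syntax)
open import Data.Rational using (ℚ; 0ℚ; ∣_∣; _-_) renaming (_<_ to _<ℚ_)

open import Data.Nat as ℕ using (zero; suc; _!; _∸_; _^_; s≤s; NonZero)
import Data.Nat.Properties as ℕP
open import Data.Integer as ℤ using (+_)
import Data.Integer.Properties as ℤP
open import Data.Rational using (1ℚ; _+_; _*_; toℚᵘ)
import Data.Rational.Properties as ℚP
import Data.Rational.Unnormalised as U
import Data.Rational.Unnormalised.Properties as UP
open import Data.Product using (_,_)
open import Data.List using (List; []; _∷_)
open import Relation.Binary.PropositionalEquality
import Data.Nat.Solver as ℕSolver
import Data.Integer.Solver as ℤSolver
import Data.Rational.Solver as ℚSolver


toℚᵘ-fromℕ : ∀ a → toℚᵘ (fromℕ a) U.≃ U.mkℚᵘ (+ a) 0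
toℚᵘ-fromℕ a = ℚP.toℚᵘ-fromℚᵘ (U.mkℚᵘ (+ a) 0)

fromℕ-homo-+ : ∀ a b → fromℕ (a ℕ.+ b) ≡ fromℕ a + fromℕ b
fromℕ-homo-+ a b = ℚP.toℚᵘ-injective (begin
  toℚᵘ (fromℕ (a ℕ.+ b))                       ≈⟨ toℚᵘ-fromℕ (a ℕ.+ b) ⟩
  U.mkℚᵘ (+ (a ℕ.+ b)) 0                        ≈⟨ U.*≡* cross ⟩
  U.mkℚᵘ (+ a) 0 U.+ U.mkℚᵘ (+ b) 0             ≈⟨ UP.+-cong (toℚᵘ-fromℕ a) (toℚᵘ-fromℕ b) ⟨
  toℚᵘ (fromℕ a) U.+ toℚᵘ (fromℕ b)             ≈⟨ ℚP.toℚᵘ-homo-+ (fromℕ a) (fromℕ b) ⟨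
  toℚᵘ (fromℕ a + fromℕ b)                      ∎)
  where
  open UP.≃-Reasoning
  open ℤSolver.+-*-Solver
  cross : + (a ℕ.+ b) ℤ.* + 1 ≡ (+ a ℤ.* + 1 ℤ.+ + b ℤ.* + 1) ℤ.* + 1
  cross rewrite ℤP.pos-+ a b =
    solve 2 (λ x y → (x :+ y) :* con (+ 1) := (x :* con (+ 1) :+ y :* con (+ 1)) :* con (+ 1)) refl (+ a) (+ b)

fromℕ-homo-* : ∀ a b → fromℕ (a ℕ.* b) ≡ fromℕ a * fromℕ b
fromℕ-homo-* a b = ℚP.toℚᵘ-injective (begin
  toℚᵘ (fromℕ (a ℕ.* b))                       ≈⟨ toℚᵘ-fromℕ (a ℕ.* b) ⟩
  U.mkℚᵘ (+ (a ℕ.* b)) 0                        ≈⟨ U.*≡* (cong (ℤ._* + 1) (ℤP.pos-* a b)) ⟩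
  U.mkℚᵘ (+ a) 0 U.* U.mkℚᵘ (+ b) 0             ≈⟨ UP.*-cong (toℚᵘ-fromℕ a) (toℚᵘ-fromℕ b) ⟨
  toℚᵘ (fromℕ a) U.* toℚᵘ (fromℕ b)             ≈⟨ ℚP.toℚᵘ-homo-* (fromℕ a) (fromℕ b) ⟨
  toℚᵘ (fromℕ a * fromℕ b)                      ∎)
  where open UP.≃-Reasoning

inv-inverseˡ : ∀ n .{{_ : NonZero n}} → inv n * fromℕ n ≡ 1ℚ
inv-inverseˡ (suc a) = ℚP.toℚᵘ-injective (begin
  toℚᵘ (inv (suc a) * fromℕ (suc a))              ≈⟨ ℚP.toℚᵘ-homo-* (inv (suc a)) (fromℕ (suc a)) ⟩
  toℚᵘ (inv (suc a)) U.* toℚᵘ (fromℕ (suc a))     ≈⟨ UP.*-cong (ℚP.toℚᵘ-fromℚᵘ (U.mkℚᵘ (+ 1) a)) (toℚᵘ-fromℕ (suc a)) ⟩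
  U.mkℚᵘ (+ 1) a U.* U.mkℚᵘ (+ suc a) 0          ≈⟨ U.*≡* cross ⟩
  U.1ℚᵘ                                          ∎)
  where
  open UP.≃-Reasoning
  cross : (+ 1 ℤ.* + suc a) ℤ.* + 1 ≡ + 1 ℤ.* + suc (a ℕ.* 1)
  cross rewrite ℕP.*-identityʳ a =
    solve 1 (λ x → (con (+ 1) :* x) :* con (+ 1) := con (+ 1) :* x) refl (+ suc a)
    where open ℤSolver.+-*-Solver

inv-unique : ∀ n .{{_ : NonZero n}} x → x * fromℕ n ≡ 1ℚ → x ≡ inv n
inv-unique n x x*n≡1 = begin
  x                        ≡⟨ ℚP.*-identityʳ x ⟨
  x * 1ℚ                   ≡⟨ cong (x *_) (trans (ℚP.*-comm (fromℕ n) (inv n)) (inv-inverseˡ n)) ⟨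
  x * (fromℕ n * inv n)    ≡⟨ ℚP.*-assoc x (fromℕ n) (inv n) ⟨
  x * fromℕ n * inv n      ≡⟨ cong (_* inv n) x*n≡1 ⟩
  1ℚ * inv n               ≡⟨ ℚP.*-identityˡ (inv n) ⟩
  inv n                    ∎
  where open ≡-Reasoning

inv-homo-* : ∀ a b .{{_ : NonZero a}} .{{_ : NonZero b}} → inv (a ℕ.* b) ≡ inv a * inv b
inv-homo-* a b = sym (inv-unique (a ℕ.* b) {{ℕP.m*n≢0 a b}} (inv a * inv b) (begin
  inv a * inv b * fromℕ (a ℕ.* b)              ≡⟨ cong (inv a * inv b *_) (fromℕ-homo-* a b) ⟩
  inv a * inv b * (fromℕ a * fromℕ b)          ≡⟨ solve 4 (λ x y z w → x :* y :* (z :* w) := (x :* z) :* (y :* w)) refl (inv a) (inv b) (fromℕ a) (fromℕ b) ⟩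
  inv a * fromℕ a * (inv b * fromℕ b)          ≡⟨ cong₂ _*_ (inv-inverseˡ a) (inv-inverseˡ b) ⟩
  1ℚ                                           ∎))
  where open ≡-Reasoning; open ℚSolver.+-*-Solver

inv-^-+ : ∀ a s t .{{_ : NonZero a}} → inv (a ^ s) ≡ fromℕ (a ^ t) * inv (a ^ (s ℕ.+ t))
inv-^-+ a s t = begin
  inv (a ^ s)                                  ≡⟨ ℚP.*-identityˡ (inv (a ^ s)) ⟨
  1ℚ * inv (a ^ s)                             ≡⟨ cong (_* inv (a ^ s)) (inv-inverseˡ (a ^ t) {{ℕP.m^n≢0 a t}}) ⟨
  inv (a ^ t) * fromℕ (a ^ t) * inv (a ^ s)   ≡⟨ solve 3 (λ x y z → x :* y :* z := y :* (z :* x)) refl (inv (a ^ t)) (fromℕ (a ^ t)) (inv (a ^ s)) ⟩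
  fromℕ (a ^ t) * (inv (a ^ s) * inv (a ^ t)) ≡⟨ cong (fromℕ (a ^ t) *_) (inv-homo-* (a ^ s) (a ^ t) {{ℕP.m^n≢0 a s}} {{ℕP.m^n≢0 a t}}) ⟨
  fromℕ (a ^ t) * inv (a ^ s ℕ.* a ^ t)       ≡⟨ cong (λ e → fromℕ (a ^ t) * inv e) (ℕP.^-distribˡ-+-* a s t) ⟨
  fromℕ (a ^ t) * inv (a ^ (s ℕ.+ t))         ∎
  where open ≡-Reasoning; open ℚSolver.+-*-Solver

sumTo-cong : ∀ {f g : ℕ → ℚ} N → (∀ k → k < N → f (suc k) ≡ g (suc k)) → sumTo f N ≡ sumTo g N
sumTo-cong zero    f≗g = refl
sumTo-cong (suc N) f≗g = cong₂ _+_ (sumTo-cong N (λ k k<N → f≗g k (ℕP.m<n⇒m<1+n k<N))) (f≗g N ℕP.≤-refl)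

sumTo-zero : ∀ N → sumTo (λ _ → 0ℚ) N ≡ 0ℚ
sumTo-zero zero    = refl
sumTo-zero (suc N) = cong (_+ 0ℚ) (sumTo-zero N)

sumTo-+ : ∀ (f g : ℕ → ℚ) N → sumTo (λ n → f n + g n) N ≡ sumTo f N + sumTo g N
sumTo-+ f g zero    = refl
sumTo-+ f g (suc N) = begin
  sumTo (λ n → f n + g n) N + (f (suc N) + g (suc N))   ≡⟨ cong (_+ (f (suc N) + g (suc N))) (sumTo-+ f g N) ⟩
  sumTo f N + sumTo g N + (f (suc N) + g (suc N))       ≡⟨ solve 4 (λ a b c d → (a :+ b) :+ (c :+ d) := (a :+ c) :+ (b :+ d)) refl (sumTo f N) (sumTo g N) (f (suc N)) (g (suc N)) ⟩
  sumTo f N + f (suc N) + (sumTo g N + g (suc N))       ∎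
  where open ≡-Reasoning; open ℚSolver.+-*-Solver

sumTo-distribˡ : ∀ c (f : ℕ → ℚ) N → c * sumTo f N ≡ sumTo (λ n → c * f n) N
sumTo-distribˡ c f zero    = ℚP.*-zeroʳ c
sumTo-distribˡ c f (suc N) =
  trans (ℚP.*-distribˡ-+ c (sumTo f N) (f (suc N))) (cong (_+ c * f (suc N)) (sumTo-distribˡ c f N))

sumTo-distribʳ : ∀ c (f : ℕ → ℚ) N → sumTo f N * c ≡ sumTo (λ n → f n * c) N
sumTo-distribʳ c f N = begin
  sumTo f N * c                 ≡⟨ ℚP.*-comm (sumTo f N) c ⟩
  c * sumTo f N                 ≡⟨ sumTo-distribˡ c f N ⟩
  sumTo (λ n → c * f n) N       ≡⟨ sumTo-cong N (λ k _ → ℚP.*-comm c (f (suc k))) ⟩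
  sumTo (λ n → f n * c) N       ∎
  where open ≡-Reasoning

sumTo-- : ∀ (f g : ℕ → ℚ) N → sumTo (λ n → f n - g n) N ≡ sumTo f N - sumTo g N
sumTo-- f g zero    = refl
sumTo-- f g (suc N) = begin
  sumTo (λ n → f n - g n) N + (f (suc N) - g (suc N))   ≡⟨ cong (_+ (f (suc N) - g (suc N))) (sumTo-- f g N) ⟩
  sumTo f N - sumTo g N + (f (suc N) - g (suc N))       ≡⟨ solve 4 (λ a b c d → (a :- b) :+ (c :- d) := (a :+ c) :- (b :+ d)) refl (sumTo f N) (sumTo g N) (f (suc N)) (g (suc N)) ⟩
  sumTo f N + f (suc N) - (sumTo g N + g (suc N))       ∎
  where open ≡-Reasoning; open ℚSolver.+-*-Solver

sumTo-swap : ∀ (g : ℕ → ℕ → ℚ) R N →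
  sumTo (λ j → sumTo (g j) N) R ≡ sumTo (λ n → sumTo (λ j → g j n) R) N
sumTo-swap g zero    N = sym (sumTo-zero N)
sumTo-swap g (suc R) N = begin
  sumTo (λ j → sumTo (g j) N) R + sumTo (g (suc R)) N
    ≡⟨ cong (_+ sumTo (g (suc R)) N) (sumTo-swap g R N) ⟩
  sumTo (λ n → sumTo (λ j → g j n) R) N + sumTo (g (suc R)) N
    ≡⟨ sumTo-+ (λ n → sumTo (λ j → g j n) R) (g (suc R)) N ⟨
  sumTo (λ n → sumTo (λ j → g j n) (suc R)) N  ∎
  where open ≡-Reasoning

sumTo-sucˡ : ∀ (f : ℕ → ℚ) N → sumTo f (suc N) ≡ f 1 + sumTo (λ n → f (suc n)) N
sumTo-sucˡ f zero    = trans (ℚP.+-identityˡ (f 1)) (sym (ℚP.+-identityʳ (f 1)))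
sumTo-sucˡ f (suc N) =
  trans (cong (_+ f (suc (suc N))) (sumTo-sucˡ f N)) (ℚP.+-assoc (f 1) _ (f (suc (suc N))))

-- Defs keeps its polynomial helpers private.  The two metavariables below are
-- solved by unification against the unfolded definitions, which names them here.
mutual
  coeffOf : List ℕ → ℕ → ℕ
  coeffOf = _

  stirling1≡coeffOf : ∀ r k → stirling1 r k ≡ coeffOf (rising r) k
  stirling1≡coeffOf r k with rising r
  ... | p = refl

mutual
  mulLinTail : ℕ → ℕ → List ℕ → List ℕ
  mulLinTail = _

  mulLin-∷ : ∀ c a p → mulLin c (a ∷ p) ≡ (c ℕ.* a ℕ.+ 0) ∷ mulLinTail c a p
  mulLin-∷ c a p = refl

coeffOf-mulLinTail : ∀ c a p k → coeffOf (mulLinTail c a p) k ≡ c ℕ.* coeffOf p k ℕ.+ coeffOf (a ∷ p) k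
coeffOf-mulLinTail c a []      k       = cong (ℕ._+ coeffOf (a ∷ []) k) (sym (ℕP.*-zeroʳ c))
coeffOf-mulLinTail c a (b ∷ p) zero    = refl
coeffOf-mulLinTail c a (b ∷ p) (suc k) = coeffOf-mulLinTail c b p k

coeffOf-mulLin : ∀ c p k → coeffOf (mulLin c p) k ≡ c ℕ.* coeffOf p k ℕ.+ coeffOf (0 ∷ p) k
coeffOf-mulLin c []      k       = cong (ℕ._+ coeffOf (0 ∷ []) k) (sym (ℕP.*-zeroʳ c))
coeffOf-mulLin c (a ∷ p) zero    = refl
coeffOf-mulLin c (a ∷ p) (suc k) = coeffOf-mulLinTail c a p k

stirling1-suc-zero : ∀ r → stirling1 (suc r) 0 ≡ r ℕ.* stirling1 r 0
stirling1-suc-zero r = trans (coeffOf-mulLin r (rising r) 0) (ℕP.+-identityʳ _)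

stirling1[1+r,0]≡0 : ∀ r → stirling1 (suc r) 0 ≡ 0
stirling1[1+r,0]≡0 zero    = refl
stirling1[1+r,0]≡0 (suc r) = begin
  stirling1 (suc (suc r)) 0      ≡⟨ stirling1-suc-zero (suc r) ⟩
  suc r ℕ.* stirling1 (suc r) 0  ≡⟨ cong (suc r ℕ.*_) (stirling1[1+r,0]≡0 r) ⟩
  suc r ℕ.* 0                    ≡⟨ ℕP.*-zeroʳ (suc r) ⟩
  0                              ∎
  where open ≡-Reasoning

stirling1-suc-suc : ∀ r k → stirling1 (suc r) (suc k) ≡ r ℕ.* stirling1 r (suc k) ℕ.+ stirling1 r k
stirling1-suc-suc r k = coeffOf-mulLin r (rising r) (suc k)

stirling1-> : ∀ {r k} → r < k → stirling1 r k ≡ 0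
stirling1-> {zero}  {suc k} _         = refl
stirling1-> {suc r} {suc k} (s≤s r<k) = begin
  stirling1 (suc r) (suc k)                      ≡⟨ stirling1-suc-suc r k ⟩
  r ℕ.* stirling1 r (suc k) ℕ.+ stirling1 r k    ≡⟨ cong₂ (λ s t → r ℕ.* s ℕ.+ t) (stirling1-> (ℕP.m<n⇒m<1+n r<k)) (stirling1-> r<k) ⟩
  r ℕ.* 0 ℕ.+ 0                                  ≡⟨ cong (ℕ._+ 0) (ℕP.*-zeroʳ r) ⟩
  0                                              ∎
  where open ≡-Reasoning

risingFactorial : ℕ → ℕ → ℕ
risingFactorial x zero    = 1
risingFactorial x (suc r) = risingFactorial x r ℕ.* (x ℕ.+ r)

risingFactorial-suc : ∀ x r → risingFactorial x (suc r) ≡ x ℕ.* risingFactorial (suc x) r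
risingFactorial-suc x zero    = trans (ℕP.*-identityˡ (x ℕ.+ 0)) (trans (ℕP.+-identityʳ x) (sym (ℕP.*-identityʳ x)))
risingFactorial-suc x (suc r) = begin
  risingFactorial x (suc r) ℕ.* (x ℕ.+ suc r)           ≡⟨ cong₂ ℕ._*_ (risingFactorial-suc x r) (ℕP.+-suc x r) ⟩
  x ℕ.* risingFactorial (suc x) r ℕ.* (suc x ℕ.+ r)     ≡⟨ ℕP.*-assoc x _ _ ⟩
  x ℕ.* (risingFactorial (suc x) r ℕ.* (suc x ℕ.+ r))   ∎
  where open ≡-Reasoning

stirling1-risingFactorial : ∀ r x →
  fromℕ (stirling1 r 0) + sumTo (λ k → fromℕ (stirling1 r k ℕ.* x ^ k)) r ≡ fromℕ (risingFactorial x r)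
stirling1-risingFactorial zero    x = ℚP.+-identityʳ 1ℚ
stirling1-risingFactorial (suc r) x = begin
  fromℕ (stirling1 (suc r) 0) + sumTo (term (suc r)) (suc r)
    ≡⟨ cong₂ _+_ (trans (cong fromℕ (stirling1-suc-zero r)) (fromℕ-homo-* r (stirling1 r 0)))
                 (sumTo-cong (suc r) (λ k _ → term-suc k)) ⟩
  ρ * c₀ + sumTo (λ k → ρ * term r k + ξ * term r (ℕ.pred k)) (suc r)
    ≡⟨ cong (λ s → ρ * c₀ + s) (trans (sumTo-+ _ _ (suc r)) (cong₂ _+_ (sym (sumTo-distribˡ ρ (term r) (suc r))) (sym (sumTo-distribˡ ξ _ (suc r))))) ⟩
  ρ * c₀ + (ρ * (A + term r (suc r)) + ξ * sumTo (λ k → term r (ℕ.pred k)) (suc r))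
    ≡⟨ cong₂ (λ s t → ρ * c₀ + (ρ * (A + s) + ξ * t)) top (sumTo-sucˡ (λ k → term r (ℕ.pred k)) r) ⟩
  ρ * c₀ + (ρ * (A + 0ℚ) + ξ * (term r 0 + A))
    ≡⟨ cong (λ s → ρ * c₀ + (ρ * (A + 0ℚ) + ξ * (s + A))) (cong fromℕ (ℕP.*-identityʳ (stirling1 r 0))) ⟩
  ρ * c₀ + (ρ * (A + 0ℚ) + ξ * (c₀ + A))
    ≡⟨ regroup ⟩
  (c₀ + A) * (ξ + ρ)
    ≡⟨ cong₂ _*_ (stirling1-risingFactorial r x) (sym (fromℕ-homo-+ x r)) ⟩
  fromℕ (risingFactorial x r) * fromℕ (x ℕ.+ r)
    ≡⟨ fromℕ-homo-* (risingFactorial x r) (x ℕ.+ r) ⟨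
  fromℕ (risingFactorial x (suc r)) ∎
  where
  open ≡-Reasoning
  term : ℕ → ℕ → ℚ
  term r k = fromℕ (stirling1 r k ℕ.* x ^ k)
  ρ ξ c₀ A : ℚ
  ρ = fromℕ r
  ξ = fromℕ x
  c₀ = fromℕ (stirling1 r 0)
  A = sumTo (term r) r
  term-suc : ∀ k → term (suc r) (suc k) ≡ ρ * term r (suc k) + ξ * term r k
  term-suc k = begin
    fromℕ (stirling1 (suc r) (suc k) ℕ.* x ^ suc k)
      ≡⟨ cong (λ s → fromℕ (s ℕ.* x ^ suc k)) (stirling1-suc-suc r k) ⟩
    fromℕ ((r ℕ.* a ℕ.+ b) ℕ.* (x ℕ.* y))
      ≡⟨ cong fromℕ (solve 5 (λ r a b x y → (r :* a :+ b) :* (x :* y) := r :* (a :* (x :* y)) :+ x :* (b :* y)) refl r a b x y) ⟩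
    fromℕ (r ℕ.* (a ℕ.* x ^ suc k) ℕ.+ x ℕ.* (b ℕ.* y))
      ≡⟨ trans (fromℕ-homo-+ (r ℕ.* (a ℕ.* x ^ suc k)) (x ℕ.* (b ℕ.* y)))
               (cong₂ _+_ (fromℕ-homo-* r (a ℕ.* x ^ suc k)) (fromℕ-homo-* x (b ℕ.* y))) ⟩
    ρ * term r (suc k) + ξ * term r k ∎
    where
    open ℕSolver.+-*-Solver
    a = stirling1 r (suc k)
    b = stirling1 r k
    y = x ^ k
  regroup : ρ * c₀ + (ρ * (A + 0ℚ) + ξ * (c₀ + A)) ≡ (c₀ + A) * (ξ + ρ)
  regroup = solve 4 (λ ρ ξ c A → ρ :* c :+ (ρ :* (A :+ con 0ℚ) :+ ξ :* (c :+ A)) := (c :+ A) :* (ξ :+ ρ)) refl ρ ξ c₀ A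
    where open ℚSolver.+-*-Solver
  top : term r (suc r) ≡ 0ℚ
  top = cong (λ s → fromℕ (s ℕ.* x ^ suc r)) (stirling1-> (ℕP.n<1+n r))

hyp-closedForm : ∀ r n → fromℕ (r !) * hyp (suc r) n ≡ fromℕ (risingFactorial (suc n) r) * (H (n ℕ.+ r) - H r)
hyp-closedForm zero n rewrite ℕP.+-identityʳ n =
  solve 1 (λ h → con 1ℚ :* h := con 1ℚ :* (h :- con 0ℚ)) refl (H n)
  where open ℚSolver.+-*-Solver
hyp-closedForm (suc r) zero =
  solve 3 (λ a b h → a :* con 0ℚ := b :* (h :- h)) refl (fromℕ (suc r !)) (fromℕ (risingFactorial 1 (suc r))) (H (suc r))
  where open ℚSolver.+-*-Solver
hyp-closedForm (suc r) (suc n) = begin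
  fromℕ (suc r ℕ.* r !) * (hyp (suc (suc r)) n + hyp (suc r) (suc n))
    ≡⟨ cong (_* (hyp (suc (suc r)) n + hyp (suc r) (suc n))) (fromℕ-homo-* (suc r) (r !)) ⟩
  σ * fromℕ (r !) * (hyp (suc (suc r)) n + hyp (suc r) (suc n))
    ≡⟨ pascal (trans (cong (_* hyp (suc (suc r)) n) (sym (fromℕ-homo-* (suc r) (r !)))) ih₁) (hyp-closedForm r (suc n)) ⟩
  a * (ν + σ) * ((X + inv (suc (suc (n ℕ.+ r)))) - (H r + inv (suc r)))
    ≡⟨ cong₂ (λ b Y → b * (Y - H (suc r))) a[ν+σ] (cong H (sym n+2+r)) ⟩
  fromℕ (risingFactorial (suc (suc n)) (suc r)) * (H (suc n ℕ.+ suc r) - H (suc r)) ∎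
  where
  open ≡-Reasoning
  σ ν a X : ℚ
  σ = fromℕ (suc r)
  ν = fromℕ (suc n)
  a = fromℕ (risingFactorial (suc (suc n)) r)
  X = H (suc (n ℕ.+ r))
  n+2+r : suc n ℕ.+ suc r ≡ suc (suc (n ℕ.+ r))
  n+2+r = cong suc (ℕP.+-suc n r)
  ν+σ : ν + σ ≡ fromℕ (suc (suc (n ℕ.+ r)))
  ν+σ = trans (sym (fromℕ-homo-+ (suc n) (suc r))) (cong fromℕ n+2+r)
  a[ν+σ] : a * (ν + σ) ≡ fromℕ (risingFactorial (suc (suc n)) (suc r))
  a[ν+σ] = trans (cong (a *_) ν+σ) (sym (fromℕ-homo-* (risingFactorial (suc (suc n)) r) (suc (suc (n ℕ.+ r)))))
  ih₁ : fromℕ (suc r !) * hyp (suc (suc r)) n ≡ ν * a * (X - (H r + inv (suc r)))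
  ih₁ = begin
    fromℕ (suc r !) * hyp (suc (suc r)) n
      ≡⟨ hyp-closedForm (suc r) n ⟩
    fromℕ (risingFactorial (suc n) (suc r)) * (H (n ℕ.+ suc r) - H (suc r))
      ≡⟨ cong₂ (λ b Y → b * (Y - H (suc r)))
           (trans (cong fromℕ (risingFactorial-suc (suc n) r)) (fromℕ-homo-* (suc n) (risingFactorial (suc (suc n)) r)))
           (cong H (ℕP.+-suc n r)) ⟩
    ν * a * (X - (H r + inv (suc r))) ∎
  pascal : ∀ {y₁ y₂} → σ * fromℕ (r !) * y₁ ≡ ν * a * (X - (H r + inv (suc r))) → fromℕ (r !) * y₂ ≡ a * (X - H r) →
           σ * fromℕ (r !) * (y₁ + y₂) ≡ a * (ν + σ) * ((X + inv (suc (suc (n ℕ.+ r)))) - (H r + inv (suc r)))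
  pascal {y₁} {y₂} e₁ e₂ = begin
    σ * u * (y₁ + y₂)
      ≡⟨ solve 4 (λ s u y₁ y₂ → s :* u :* (y₁ :+ y₂) := s :* u :* y₁ :+ s :* (u :* y₂)) refl σ u y₁ y₂ ⟩
    σ * u * y₁ + σ * (u * y₂)
      ≡⟨ cong₂ _+_ e₁ (cong (σ *_) e₂) ⟩
    ν * a * (X - (h + p)) + σ * (a * (X - h))
      ≡⟨ solve 6 (λ ν a X h p σ → ν :* a :* (X :- (h :+ p)) :+ σ :* (a :* (X :- h)) := a :* (ν :+ σ) :* (X :- (h :+ p)) :+ a :* (σ :* p)) refl ν a X h p σ ⟩
    a * (ν + σ) * (X - (h + p)) + a * (σ * p)
      ≡⟨ cong (λ z → a * (ν + σ) * (X - (h + p)) + a * z) (trans σp≡1 (sym [ν+σ]q≡1)) ⟩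
    a * (ν + σ) * (X - (h + p)) + a * ((ν + σ) * q)
      ≡⟨ solve 7 (λ ν a X h p σ q → a :* (ν :+ σ) :* (X :- (h :+ p)) :+ a :* ((ν :+ σ) :* q) := a :* (ν :+ σ) :* ((X :+ q) :- (h :+ p))) refl ν a X h p σ q ⟩
    a * (ν + σ) * ((X + q) - (h + p)) ∎
    where
    open ℚSolver.+-*-Solver
    u = fromℕ (r !)
    h = H r
    p = inv (suc r)
    q = inv (suc (suc (n ℕ.+ r)))
    σp≡1 : σ * p ≡ 1ℚ
    σp≡1 = trans (ℚP.*-comm σ p) (inv-inverseˡ (suc r))
    [ν+σ]q≡1 : (ν + σ) * q ≡ 1ℚ
    [ν+σ]q≡1 = trans (cong (_* q) ν+σ) (trans (ℚP.*-comm _ q) (inv-inverseˡ (suc (suc (n ℕ.+ r)))))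

H-+ : ∀ n r → H n + sumTo (λ j → inv (n ℕ.+ j)) r ≡ H (n ℕ.+ r)
H-+ n zero    = trans (ℚP.+-identityʳ (H n)) (cong H (sym (ℕP.+-identityʳ n)))
H-+ n (suc r) rewrite ℕP.+-suc n r =
  trans (sym (ℚP.+-assoc (H n) _ (inv (suc (n ℕ.+ r))))) (cong (_+ inv (suc (n ℕ.+ r))) (H-+ n r))

bracket≡sumTo : ∀ s r N →
  zetaHN s N - H r * zetaN s N + sumTo (λ j → muN s j N) r ≡ sumTo (λ n → inv (n ^ s) * (H (n ℕ.+ r) - H r)) N
bracket≡sumTo s r N = begin
  zetaHN s N - H r * zetaN s N + sumTo (λ j → muN s j N) r
    ≡⟨ cong₂ (λ A B → zetaHN s N - A + B) (sumTo-distribˡ (H r) (λ n → inv (n ^ s)) N) (sumTo-swap (λ j n → inv (n ^ s ℕ.* (n ℕ.+ j))) r N) ⟩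
  zetaHN s N - sumTo (λ n → H r * inv (n ^ s)) N + sumTo μ N
    ≡⟨ cong (_+ sumTo μ N) (sumTo-- (λ n → H n * inv (n ^ s)) (λ n → H r * inv (n ^ s)) N) ⟨
  sumTo (λ n → H n * inv (n ^ s) - H r * inv (n ^ s)) N + sumTo μ N
    ≡⟨ sumTo-+ (λ n → H n * inv (n ^ s) - H r * inv (n ^ s)) μ N ⟨
  sumTo (λ n → H n * inv (n ^ s) - H r * inv (n ^ s) + μ n) N
    ≡⟨ sumTo-cong N (λ k _ → summand (suc k)) ⟩
  sumTo (λ n → inv (n ^ s) * (H (n ℕ.+ r) - H r)) N ∎
  where
  open ≡-Reasoning
  μ : ℕ → ℚ
  μ n = sumTo (λ j → inv (n ^ s ℕ.* (n ℕ.+ j))) r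
  summand : ∀ n .{{_ : NonZero n}} → H n * inv (n ^ s) - H r * inv (n ^ s) + μ n ≡ inv (n ^ s) * (H (n ℕ.+ r) - H r)
  summand n@(suc _) = begin
    H n * i - H r * i + μ n
      ≡⟨ cong (λ z → H n * i - H r * i + z)
           (trans (sumTo-cong r (λ j _ → inv-homo-* (n ^ s) (n ℕ.+ suc j) {{ℕP.m^n≢0 n s}})) (sym (sumTo-distribˡ i _ r))) ⟩
    H n * i - H r * i + i * T
      ≡⟨ solve 4 (λ h c i t → h :* i :- c :* i :+ i :* t := i :* ((h :+ t) :- c)) refl (H n) (H r) i T ⟩
    i * ((H n + T) - H r)
      ≡⟨ cong (λ z → i * (z - H r)) (H-+ n r) ⟩
    i * (H (n ℕ.+ r) - H r) ∎
    where
    open ℚSolver.+-*-Solver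
    i = inv (n ^ s)
    T = sumTo (λ j → inv (n ℕ.+ j)) r

stirling1-inv-^ : ∀ r m n .{{_ : NonZero n}} → suc r ≤ m →
  sumTo (λ k → fromℕ (stirling1 (suc r) k) * inv (n ^ (m ∸ k ℕ.+ 1))) (suc r)
    ≡ fromℕ (risingFactorial (suc n) r) * inv (n ^ m)
stirling1-inv-^ r m n 1+r≤m = begin
  sumTo (λ k → fromℕ (stirling1 (suc r) k) * inv (n ^ (m ∸ k ℕ.+ 1))) (suc r)
    ≡⟨ sumTo-cong (suc r) (λ k k≤r → summand (suc k) (ℕP.≤-trans k≤r 1+r≤m)) ⟩
  sumTo (λ k → fromℕ (stirling1 (suc r) k ℕ.* n ^ k) * I) (suc r)
    ≡⟨ sumTo-distribʳ I (λ k → fromℕ (stirling1 (suc r) k ℕ.* n ^ k)) (suc r) ⟨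
  sumTo (λ k → fromℕ (stirling1 (suc r) k ℕ.* n ^ k)) (suc r) * I
    ≡⟨ cong (_* I) polynomial ⟩
  fromℕ (risingFactorial n (suc r)) * I
    ≡⟨ cong (λ z → fromℕ z * I) (trans (risingFactorial-suc n r) (ℕP.*-comm n _)) ⟩
  fromℕ (risingFactorial (suc n) r ℕ.* n) * I
    ≡⟨ cong (λ z → fromℕ (risingFactorial (suc n) r ℕ.* z) * I) (ℕP.*-identityʳ n) ⟨
  fromℕ (risingFactorial (suc n) r ℕ.* n ^ 1) * I
    ≡⟨ trans (cong (_* I) (fromℕ-homo-* (risingFactorial (suc n) r) (n ^ 1))) (ℚP.*-assoc (fromℕ (risingFactorial (suc n) r)) (fromℕ (n ^ 1)) I) ⟩
  fromℕ (risingFactorial (suc n) r) * (fromℕ (n ^ 1) * I)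
    ≡⟨ cong (fromℕ (risingFactorial (suc n) r) *_) (inv-^-+ n m 1) ⟨
  fromℕ (risingFactorial (suc n) r) * inv (n ^ m) ∎
  where
  open ≡-Reasoning
  I = inv (n ^ (m ℕ.+ 1))
  summand : ∀ k → k ≤ m → fromℕ (stirling1 (suc r) k) * inv (n ^ (m ∸ k ℕ.+ 1)) ≡ fromℕ (stirling1 (suc r) k ℕ.* n ^ k) * I
  summand k k≤m = begin
    fromℕ (stirling1 (suc r) k) * inv (n ^ (m ∸ k ℕ.+ 1))
      ≡⟨ cong (fromℕ (stirling1 (suc r) k) *_) (inv-^-+ n (m ∸ k ℕ.+ 1) k) ⟩
    fromℕ (stirling1 (suc r) k) * (fromℕ (n ^ k) * inv (n ^ (m ∸ k ℕ.+ 1 ℕ.+ k)))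
      ≡⟨ cong (λ e → fromℕ (stirling1 (suc r) k) * (fromℕ (n ^ k) * inv (n ^ e))) exponent ⟩
    fromℕ (stirling1 (suc r) k) * (fromℕ (n ^ k) * I)
      ≡⟨ ℚP.*-assoc (fromℕ (stirling1 (suc r) k)) (fromℕ (n ^ k)) I ⟨
    fromℕ (stirling1 (suc r) k) * fromℕ (n ^ k) * I
      ≡⟨ cong (_* I) (fromℕ-homo-* (stirling1 (suc r) k) (n ^ k)) ⟨
    fromℕ (stirling1 (suc r) k ℕ.* n ^ k) * I ∎
    where
    exponent : m ∸ k ℕ.+ 1 ℕ.+ k ≡ m ℕ.+ 1
    exponent = trans (ℕP.+-assoc (m ∸ k) 1 k) (trans (cong (m ∸ k ℕ.+_) (ℕP.+-comm 1 k))
                 (trans (sym (ℕP.+-assoc (m ∸ k) k 1)) (cong (ℕ._+ 1) (ℕP.m∸n+n≡m k≤m))))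
  polynomial : sumTo (λ k → fromℕ (stirling1 (suc r) k ℕ.* n ^ k)) (suc r) ≡ fromℕ (risingFactorial n (suc r))
  polynomial = begin
    sumTo (λ k → fromℕ (stirling1 (suc r) k ℕ.* n ^ k)) (suc r)
      ≡⟨ ℚP.+-identityˡ _ ⟨
    0ℚ + sumTo (λ k → fromℕ (stirling1 (suc r) k ℕ.* n ^ k)) (suc r)
      ≡⟨ cong (λ c → fromℕ c + sumTo (λ k → fromℕ (stirling1 (suc r) k ℕ.* n ^ k)) (suc r)) (stirling1[1+r,0]≡0 r) ⟨
    fromℕ (stirling1 (suc r) 0) + sumTo (λ k → fromℕ (stirling1 (suc r) k ℕ.* n ^ k)) (suc r)
      ≡⟨ stirling1-risingFactorial (suc r) n ⟩
    fromℕ (risingFactorial n (suc r)) ∎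

hyp-*-inv-^ : ∀ r m n .{{_ : NonZero n}} → suc r ≤ m →
  inv (r !) * sumTo (λ k → fromℕ (stirling1 (suc r) k) * (inv (n ^ (m ∸ k ℕ.+ 1)) * (H (n ℕ.+ r) - H r))) (suc r)
    ≡ hyp (suc r) n * inv (n ^ m)
hyp-*-inv-^ r m n 1+r≤m = begin
  inv (r !) * sumTo (λ k → c k * (i k * D)) (suc r)
    ≡⟨ cong (inv (r !) *_) (sumTo-cong (suc r) (λ k _ → ℚP.*-assoc (c (suc k)) (i (suc k)) D)) ⟨
  inv (r !) * sumTo (λ k → c k * i k * D) (suc r)
    ≡⟨ cong (inv (r !) *_) (sumTo-distribʳ D (λ k → c k * i k) (suc r)) ⟨
  inv (r !) * (sumTo (λ k → c k * i k) (suc r) * D)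
    ≡⟨ cong (λ z → inv (r !) * (z * D)) (stirling1-inv-^ r m n 1+r≤m) ⟩
  inv (r !) * (ρ * inv (n ^ m) * D)
    ≡⟨ solve 4 (λ a ρ i D → a :* (ρ :* i :* D) := a :* (ρ :* D) :* i) refl (inv (r !)) ρ (inv (n ^ m)) D ⟩
  inv (r !) * (ρ * D) * inv (n ^ m)
    ≡⟨ cong (λ z → inv (r !) * z * inv (n ^ m)) (hyp-closedForm r n) ⟨
  inv (r !) * (fromℕ (r !) * hyp (suc r) n) * inv (n ^ m)
    ≡⟨ cong (_* inv (n ^ m)) (trans (sym (ℚP.*-assoc (inv (r !)) (fromℕ (r !)) (hyp (suc r) n)))
         (trans (cong (_* hyp (suc r) n) (inv-inverseˡ (r !) {{ℕP._!≢0 r}})) (ℚP.*-identityˡ (hyp (suc r) n)))) ⟩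
  hyp (suc r) n * inv (n ^ m) ∎
  where
  open ≡-Reasoning; open ℚSolver.+-*-Solver
  c i : ℕ → ℚ
  c k = fromℕ (stirling1 (suc r) k)
  i k = inv (n ^ (m ∸ k ℕ.+ 1))
  D = H (n ℕ.+ r) - H r
  ρ = fromℕ (risingFactorial (suc n) r)

lhsN≡rhsN : ∀ r m N → suc r ≤ m → lhsN (suc r) m N ≡ rhsN (suc r) m N
lhsN≡rhsN r m N 1+r≤m = sym (begin
  rhsN (suc r) m N
    ≡⟨ cong (inv (r !) *_) (sumTo-cong (suc r) (λ k _ →
         trans (cong (c (suc k) *_) (bracket≡sumTo (s (suc k)) r N)) (sumTo-distribˡ (c (suc k)) _ N))) ⟩
  inv (r !) * sumTo (λ k → sumTo (term k) N) (suc r)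
    ≡⟨ cong (inv (r !) *_) (sumTo-swap term (suc r) N) ⟩
  inv (r !) * sumTo (λ n → sumTo (λ k → term k n) (suc r)) N
    ≡⟨ sumTo-distribˡ (inv (r !)) (λ n → sumTo (λ k → term k n) (suc r)) N ⟩
  sumTo (λ n → inv (r !) * sumTo (λ k → term k n) (suc r)) N
    ≡⟨ sumTo-cong N (λ n _ → hyp-*-inv-^ r m (suc n) 1+r≤m) ⟩
  lhsN (suc r) m N ∎)
  where
  open ≡-Reasoning
  s : ℕ → ℕ
  s k = m ∸ k ℕ.+ 1
  c : ℕ → ℚ
  c k = fromℕ (stirling1 (suc r) k)
  term : ℕ → ℕ → ℚ
  term k n = c k * (inv (n ^ s k) * (H (n ℕ.+ r) - H r))

theorem4 : (r m : ℕ) → 1 ≤ r → r < m →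
    (ε : ℚ) → 0ℚ <ℚ ε →
    ∃[ N ] ((n : ℕ) → N ≤ n → ∣ lhsN r m n - rhsN r m n ∣ <ℚ ε)
theorem4 (suc r) m _ 1+r≤m ε ε>0 = 0 , λ n _ → begin-strict
  ∣ lhsN (suc r) m n - rhsN (suc r) m n ∣   ≡⟨ cong (λ x → ∣ x - rhsN (suc r) m n ∣) (lhsN≡rhsN r m n (ℕP.<⇒≤ 1+r≤m)) ⟩
  ∣ rhsN (suc r) m n - rhsN (suc r) m n ∣   ≡⟨ cong ∣_∣ (ℚP.+-inverseʳ (rhsN (suc r) m n)) ⟩
  0ℚ                                        <⟨ ε>0 ⟩
  ε                                         ∎
  where open ℚP.≤-Reasoning
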